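{- Let $G$ be a group acting on a graph $\Sigma$ so that $\Sigma$ is $G$-symmetric, let $\Delta$ be a self-paired $G$-orbit on $\mathrm{Arc}_3(\Sigma)$, let $\Gamma=\mathrm{Arc}_\Delta(\Sigma)$, and let $\mathcal{B}=\{B(\sigma):\sigma\in V\Sigma\}$ where $B(\sigma)=\{(\sigma,\tau):\tau\text{ adjacent to }\sigma\}$. Then for every vertex $\sigma$ of $\Sigma$, the permutation groups $(G_{B(\sigma)},B(\sigma))$ and $(G_{B(\sigma)},\Gamma_{\mathcal{B}}(B(\sigma)))$ are permutation equivalent, where $G_{B(\sigma)}$ is the setwise stabilizer of $B(\sigma)$ in $G$ and $\Gamma_{\mathcal{B}}(B(\sigma))$ is the set of neighbours of $B(\sigma)$ in the quotient graph $\Gamma_{\mathcal{B}}$.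
   Context: A graph is $G$-symmetric if $G$ acts on it by automorphisms transitively on its vertices and on its arcs. An $s$-arc is a sequence $(\alpha_0,\dots,\alpha_s)$ of vertices with consecutive ones adjacent and $\alpha_{i-1}\neq\alpha_{i+1}$; $G$ acts on $3$-arcs coordinatewise. For a $G$-orbit $\Delta$ on $3$-arcs, $\Delta$ is self-paired if it equals $\{(\sigma_3,\sigma_2,\sigma_1,\sigma_0):(\sigma_0,\sigma_1,\sigma_2,\sigma_3)\in\Delta\}$. The three-arc graph $\mathrm{Arc}_\Delta(\Sigma)$ has vertex set the arcs of $\Sigma$, with $((\sigma,\tau),(\sigma',\tau'))$ an arc iff $(\tau,\sigma,\sigma',\tau')\in\Delta$. The quotient graph $\Gamma_{\mathcal{B}}$ has vertex set $\mathcal{B}$, with $B,C$ adjacent iff some vertex of $B$ is adjacent in $\Gamma$ to some vertex of $C$. Two actions of the same group $H$ on sets $X,Y$ are permutation equivalent if there is a bijection $\rho:X\to Y$ with $\rho(x^h)=\rho(x)^h$ for all $x\in X$, $h\in H$. -}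

module Defs where

open import Level using (Level; _⊔_) renaming (suc to lsuc; zero to lzero)
open import Algebra.Bundles using (Group)
open import Data.Product using (Σ; ∃; _×_; _,_; proj₁; proj₂)
open import Relation.Binary.PropositionalEquality using (_≡_; _≢_; refl; sym; trans)
open import Relation.Binary.Bundles using (Setoid)
open import Relation.Nullary using (¬_)
open import Function.Bundles using (Bijection)

-- A (right) action of a group G on a set V, written  v ^ g  =  act v g.
record Action {c ℓ} (G : Group c ℓ) (V : Set) : Set (c ⊔ ℓ) where
  open Group G
  field
    act   : V → Carrier → V
    act-ε : ∀ v → act v ε ≡ v
    act-∙ : ∀ v g h → act (act v g) h ≡ act v (g ∙ h)
    act-≈ : ∀ v {g h} → g ≈ h → act v g ≡ act v h

module Sym {c ℓ} (G : Group c ℓ) {V : Set} (E : V → V → Set) (A : Action G V) where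
  open Group G using (Carrier)
  open Action A public

  IsSimpleGraph : Set
  IsSimpleGraph = (∀ u v → E u v → E v u) × (∀ u → ¬ E u u)

  ByAutomorphisms : Set c
  ByAutomorphisms = ∀ g u v → (E u v → E (act u g) (act v g)) × (E (act u g) (act v g) → E u v)

  Arc : Set
  Arc = Σ (V × V) λ p → E (proj₁ p) (proj₂ p)

  VertexTransitive : Set c
  VertexTransitive = ∀ u v → ∃ λ (g : Carrier) → act u g ≡ v

  ArcTransitive : Set c
  ArcTransitive = ∀ u v u' v' → E u v → E u' v' →
    ∃ λ (g : Carrier) → (act u g ≡ u') × (act v g ≡ v')

  Symmetric : Set c
  Symmetric = ByAutomorphisms × VertexTransitive × ArcTransitive

  record V⁴ : Set where
    constructor q
    field a₀ a₁ a₂ a₃ : V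

  Is3Arc : V⁴ → Set
  Is3Arc (q a₀ a₁ a₂ a₃) =
    E a₀ a₁ × E a₁ a₂ × E a₂ a₃ × (a₀ ≢ a₂) × (a₁ ≢ a₃)

  act⁴ : V⁴ → Carrier → V⁴
  act⁴ (q a₀ a₁ a₂ a₃) g = q (act a₀ g) (act a₁ g) (act a₂ g) (act a₃ g)

  rev : V⁴ → V⁴
  rev (q a₀ a₁ a₂ a₃) = q a₃ a₂ a₁ a₀

  Orbit : V⁴ → V⁴ → Set c
  Orbit δ₀ x = ∃ λ (g : Carrier) → x ≡ act⁴ δ₀ g

  SelfPaired : (V⁴ → Set c) → Set c
  SelfPaired Δ = ∀ y → (Δ y → ∃ λ x → Δ x × (y ≡ rev x))
                     × ((∃ λ x → Δ x × (y ≡ rev x)) → Δ y)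

  ArcΔAdj : (V⁴ → Set c) → Arc → Arc → Set c
  ArcΔAdj Δ ((σ , τ) , _) ((σ' , τ') , _) = Δ (q τ σ σ' τ')

  actArc : Arc → Carrier → V × V
  actArc ((u , v) , _) g = (act u g , act v g)

  Pred : Set₁
  Pred = Arc → Set

  _≐_ : Pred → Pred → Set
  P ≐ Q = ∀ α → (P α → Q α) × (Q α → P α)

  B : V → Pred
  B σ ((u , _) , _) = u ≡ σ

  In𝓑 : Pred → Set
  In𝓑 P = ∃ λ σ → P ≐ B σ

  image : Pred → Carrier → Pred
  image P g β = ∃ λ α → P α × (actArc α g ≡ proj₁ β)

  InStab : V → Carrier → Set
  InStab σ g = image (B σ) g ≐ B σ

  QuotAdj : (V⁴ → Set c) → Pred → Pred → Set c
  QuotAdj Δ P Q = ∃ λ α → ∃ λ β → P α × Q β × ArcΔAdj Δ α β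

  BSetoid : V → Setoid lzero lzero
  BSetoid σ = record
    { Carrier = Σ Arc (B σ)
    ; _≈_ = λ x y → proj₁ (proj₁ x) ≡ proj₁ (proj₁ y)
    ; isEquivalence = record { refl = refl ; sym = sym ; trans = trans } }

  NbrSetoid : (V⁴ → Set c) → V → Setoid (lsuc lzero ⊔ c) lzero
  NbrSetoid Δ σ = record
    { Carrier = Σ Pred λ P → In𝓑 P × QuotAdj Δ (B σ) P
    ; _≈_ = λ P Q → proj₁ P ≐ proj₁ Q
    ; isEquivalence = record
      { refl = λ α → (λ x → x) , (λ x → x)
      ; sym = λ e α → proj₂ (e α) , proj₁ (e α)
      ; trans = λ e f α → (λ x → proj₁ (f α) (proj₁ (e α) x))
                        , (λ x → proj₂ (e α) (proj₂ (f α) x)) } }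

  -- (G_{B(σ)}, B(σ)) and (G_{B(σ)}, Γ_𝓑(B(σ))) are permutation equivalent:
  -- a bijection ρ with ρ(x^h) = ρ(x)^h for all h ∈ G_{B(σ)}.
  -- (x' below is x^h, i.e. the element of B(σ) whose underlying arc is x^h.)
  PermEquiv : (V⁴ → Set c) → V → Set (lsuc lzero ⊔ c)
  PermEquiv Δ σ = Σ (Bijection (BSetoid σ) (NbrSetoid Δ σ)) λ ρ →
    ∀ h → InStab σ h → ∀ (x x' : Σ Arc (B σ)) →
      proj₁ (proj₁ x') ≡ actArc (proj₁ x) h →
      proj₁ (Bijection.to ρ x') ≐ image (proj₁ (Bijection.to ρ x)) h

module Submission where

-- ρ sends the arc (σ, τ) of B(σ) to the block B(τ).  The middle arc of every
-- 3-arc in Δ is an arc of Σ, and by arc-transitivity every arc of Σ is such a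
-- middle arc; hence B(σ) and B(τ) are adjacent in Γ_𝓑 exactly when σ and τ
-- are adjacent in Σ, which makes ρ a bijection onto Γ_𝓑(B(σ)).  It commutes
-- with G_{B(σ)} because B(τ)^h = B(τ^h) for every automorphism h.

open import Level using (_⊔_) renaming (suc to lsuc; zero to lzero)
open import Defs
open import Algebra.Bundles using (Group)
open import Data.Product using (_×_; _,_; proj₁; proj₂; Σ; ∃)
open import Relation.Binary.PropositionalEquality
  using (_≡_; refl; sym; trans; cong; subst; subst₂)
open import Function.Bundles using (Bijection)

module _ {c ℓ} (G : Group c ℓ) {V : Set} (A : Action G V) where
  open Group G using (_⁻¹; inverseˡ)
  open Action A

  act-inverseʳ : ∀ v h → act (act v (h ⁻¹)) h ≡ v
  act-inverseʳ v h = trans (act-∙ v (h ⁻¹) h) (trans (act-≈ v (inverseˡ h)) (act-ε v))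

module Blocks {c ℓ} (G : Group c ℓ) {V : Set} (E : V → V → Set) (A : Action G V) where
  open Sym G E A
  open Group G using (_⁻¹)

  ≐-refl : ∀ {P} → P ≐ P
  ≐-refl α = (λ x → x) , (λ x → x)

  ≐-sym : ∀ {P Q} → P ≐ Q → Q ≐ P
  ≐-sym e α = proj₂ (e α) , proj₁ (e α)

  B-injective : ∀ {u v w} → E u w → B u ≐ B v → u ≡ v
  B-injective {u} {w = w} e eq = proj₁ (eq ((u , w) , e)) refl

  B-image : ByAutomorphisms → ∀ v h → B (act v h) ≐ image (B v) h
  B-image aut v h ((u , w) , e) = forward , backward
    where
      forward : u ≡ act v h → image (B v) h ((u , w) , e)
      forward refl = ((v , act w (h ⁻¹)) , e⁻) , refl , cong (act v h ,_) (act-inverseʳ G A w h)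
        where
          e⁻ : E v (act w (h ⁻¹))
          e⁻ = proj₂ (aut h v (act w (h ⁻¹)))
                     (subst (E (act v h)) (sym (act-inverseʳ G A w h)) e)

      backward : image (B v) h ((u , w) , e) → u ≡ act v h
      backward (_ , refl , eq) = sym (cong proj₁ eq)

  module _ (δ₀ : V⁴) where
    open V⁴ δ₀

    orbit-middle-edge : ByAutomorphisms → E a₁ a₂ →
      ∀ {x} → Orbit δ₀ x → E (V⁴.a₁ x) (V⁴.a₂ x)
    orbit-middle-edge aut e (g , refl) = proj₁ (aut g a₁ a₂) e

    QuotAdj-B⇒E : ByAutomorphisms → E a₁ a₂ →
      ∀ {σ w P} → QuotAdj (Orbit δ₀) (B σ) P → P ≐ B w → E σ w
    QuotAdj-B⇒E aut e (_ , β , u≡σ , Pβ , x∈Δ) P≐Bw =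
      subst₂ E u≡σ (proj₁ (P≐Bw β) Pβ) (orbit-middle-edge aut e x∈Δ)

    QuotAdj-B-translate : ByAutomorphisms → E a₁ a₀ → E a₂ a₃ →
      ∀ g → QuotAdj (Orbit δ₀) (B (act a₁ g)) (B (act a₂ g))
    QuotAdj-B-translate aut e₁₀ e₂₃ g =
      ((act a₁ g , act a₀ g) , proj₁ (aut g a₁ a₀) e₁₀) ,
      ((act a₂ g , act a₃ g) , proj₁ (aut g a₂ a₃) e₂₃) ,
      refl , refl , (g , refl)

    E⇒QuotAdj-B : ByAutomorphisms → ArcTransitive → E a₁ a₀ → E a₁ a₂ → E a₂ a₃ →
      ∀ {σ τ} → E σ τ → QuotAdj (Orbit δ₀) (B σ) (B τ)
    E⇒QuotAdj-B aut arcT e₁₀ e₁₂ e₂₃ {σ} {τ} e with arcT a₁ a₂ σ τ e₁₂ e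
    ... | g , refl , refl = QuotAdj-B-translate aut e₁₀ e₂₃ g

  -- The self-paired hypothesis of the paper only serves to make Γ undirected;
  -- Γ_𝓑(B(σ)) is read off QuotAdj directly.
  module ArcToBlock (simple : IsSimpleGraph) (symm : Symmetric)
                    (δ₀ : V⁴) (δ₀-3arc : Is3Arc δ₀) (σ : V) where
    open V⁴ δ₀

    private
      E-sym : ∀ u v → E u v → E v u
      E-sym = proj₁ simple
      aut : ByAutomorphisms
      aut = proj₁ symm
      arcT : ArcTransitive
      arcT = proj₂ (proj₂ symm)
      Δ : V⁴ → Set c
      Δ = Orbit δ₀
      e₀₁ : E a₀ a₁
      e₀₁ = proj₁ δ₀-3arc
      e₁₂ : E a₁ a₂
      e₁₂ = proj₁ (proj₂ δ₀-3arc)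
      e₂₃ : E a₂ a₃
      e₂₃ = proj₁ (proj₂ (proj₂ δ₀-3arc))

    Nbr : Set (lsuc lzero ⊔ c)
    Nbr = Σ Pred λ P → In𝓑 P × QuotAdj Δ (B σ) P

    to : Σ Arc (B σ) → Nbr
    to (((u , τ) , e) , refl) =
      B τ , (τ , ≐-refl) , E⇒QuotAdj-B δ₀ aut arcT (E-sym _ _ e₀₁) e₁₂ e₂₃ e

    to-cong : ∀ {x y : Σ Arc (B σ)} → proj₁ (proj₁ x) ≡ proj₁ (proj₁ y) →
      proj₁ (to x) ≐ proj₁ (to y)
    to-cong {(_ , refl)} {(_ , refl)} refl = ≐-refl

    to-injective : ∀ {x y : Σ Arc (B σ)} → proj₁ (to x) ≐ proj₁ (to y) →
      proj₁ (proj₁ x) ≡ proj₁ (proj₁ y)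
    to-injective {(((_ , τ) , e) , refl)} {(_ , refl)} eq
      with B-injective (E-sym _ _ e) eq
    ... | refl = refl

    to-surjective : ∀ (y : Nbr) → ∃ λ (x : Σ Arc (B σ)) →
      ∀ {z : Σ Arc (B σ)} → proj₁ (proj₁ z) ≡ proj₁ (proj₁ x) → proj₁ (to z) ≐ proj₁ y
    to-surjective (P , (w , P≐Bw) , adj) =
      (((σ , w) , QuotAdj-B⇒E δ₀ aut e₁₂ adj P≐Bw) , refl) ,
      λ { {(_ , refl)} refl → ≐-sym P≐Bw }

    ρ : Bijection (BSetoid σ) (NbrSetoid Δ σ)
    ρ = record
      { to = to
      ; cong = λ {x} {y} → to-cong {x} {y}
      ; bijective = (λ {x} {y} → to-injective {x} {y}) , to-surjective
      }

    ρ-equivariant : ∀ h → InStab σ h → ∀ (x x' : Σ Arc (B σ)) →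
      proj₁ (proj₁ x') ≡ actArc (proj₁ x) h →
      proj₁ (Bijection.to ρ x') ≐ image (proj₁ (Bijection.to ρ x)) h
    ρ-equivariant h _ (((_ , τ) , _) , refl) (((_ , τ') , _) , refl) eq
      with cong proj₂ eq
    ... | refl = B-image aut τ h

mainTheorem3 : ∀ {c ℓ} (G : Group c ℓ) {V : Set} (E : V → V → Set) (A : Action G V) →
    Sym.IsSimpleGraph G E A →
    Sym.Symmetric G E A →
    (δ₀ : Sym.V⁴ G E A) → Sym.Is3Arc G E A δ₀ →
    Sym.SelfPaired G E A (Sym.Orbit G E A δ₀) →
    (σ : V) → Sym.PermEquiv G E A (Sym.Orbit G E A δ₀) σ
mainTheorem3 G E A simple symm δ₀ δ₀-3arc _ σ = ρ , ρ-equivariant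
  where open Blocks.ArcToBlock G E A simple symm δ₀ δ₀-3arc σ
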